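{- Let $\mathcal O_{ -7,-11}=\mathbb Z\oplus\mathbb Z\omega_1\oplus\mathbb Z\omega_2\oplus\mathbb Z\omega_3\subset\mathcal H_{ -7,-11}$ with $\omega_1=\frac{1+j}2$, $\omega_2=\frac{i+ij}2$, $\omega_3=\frac{2j+ij}{11}$. There exists a subgroup $H\le\mathcal G_{ -7,-11}(\mathbb Z/2\mathbb Z)$ with $H\cong C_3$ such that $(2,H)$ is a congruence pair of $\mathcal O_{ -7,-11}$.
   Context: $\mathcal H_{ -7,-11}$ is the quaternion algebra over $\mathbb Q$ with basis $1,i,j,ij$, $i^2=-7$, $j^2=-11$, $ij=-ji$; $\mathcal O_{ -7,-11}$ is a maximal order. For a commutative ring $A$, $\mathcal G_{ -7,-11}(A)=(\mathcal O_{ -7,-11}\otimes A)^\times/A^\times$. $\phi_m:\mathcal G_{ -7,-11}(\mathbb Z)\to\mathcal G_{ -7,-11}(\mathbb Z/m\mathbb Z)$ is induced by reducing coordinates with respect to $1,\omega_1,\omega_2,\omega_3$ modulo $m$. A congruence pair is $(m,H)$, $m$ a positive integer, $H\le\mathcal G_{ -7,-11}(\mathbb Z/m\mathbb Z)$, such that $\phi_m$ is injective on $\mathcal G_{ -7,-11}(\mathbb Z)$, $H\cap\phi_m(\mathcal G_{ -7,-11}(\mathbb Z))=\{1\}$ and $\phi_m(\mathcal G_{ -7,-11}(\mathbb Z))\cdot H=\mathcal G_{ -7,-11}(\mathbb Z/m\mathbb Z)$. $C_3$ is cyclic of order 3. -}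

module Defs where

open import Data.Nat using (ℕ; zero; suc)
open import Data.Integer as ℤ using (ℤ; +_; -[1+_]; ∣_∣)
open import Data.Bool using (Bool; true; false; not; _xor_; _∧_)
open import Data.Fin using (Fin; zero; suc)
open import Data.Product using (Σ; _×_; _,_)
open import Relation.Binary.PropositionalEquality using (_≡_)

record CoeffRing : Set₁ where
  field
    A     : Set
    _+A_  : A → A → A
    _*A_  : A → A → A
    0A    : A
    1A    : A
    fromℤ : ℤ → A

-- The maximal order O_{-7,-11} = ℤ ⊕ ℤω₁ ⊕ ℤω₂ ⊕ ℤω₃ of H_{-7,-11},
-- ω₁ = (1+j)/2, ω₂ = (i+ij)/2, ω₃ = (2j+ij)/11, with i² = -7, j² = -11,
-- ij = -ji.  Its multiplication is encoded by the structure constants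
-- T p q k = k-th coordinate (basis 1,ω₁,ω₂,ω₃) of e_p · e_q,
-- where e₀ = 1, e₁ = ω₁, e₂ = ω₂, e₃ = ω₃.  (Computed from the
-- multiplication in H_{-7,-11}; all constants are integers.)

record V4 (X : Set) : Set where
  constructor ⟨_,_,_,_⟩
  field c₀ c₁ c₂ c₃ : X

coord : {X : Set} → V4 X → Fin 4 → X
coord v zero = V4.c₀ v
coord v (suc zero) = V4.c₁ v
coord v (suc (suc zero)) = V4.c₂ v
coord v (suc (suc (suc zero))) = V4.c₃ v

pos : ℕ → ℤ
pos n = + n

neg : ℕ → ℤ
neg zero = + 0
neg (suc n) = -[1+ n ]

T : Fin 4 → Fin 4 → V4 ℤ
T zero zero = ⟨ pos 1 , pos 0 , pos 0 , pos 0 ⟩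
T zero (suc zero) = ⟨ pos 0 , pos 1 , pos 0 , pos 0 ⟩
T zero (suc (suc zero)) = ⟨ pos 0 , pos 0 , pos 1 , pos 0 ⟩
T zero (suc (suc (suc zero))) = ⟨ pos 0 , pos 0 , pos 0 , pos 1 ⟩
T (suc zero) zero = ⟨ pos 0 , pos 1 , pos 0 , pos 0 ⟩
T (suc (suc zero)) zero = ⟨ pos 0 , pos 0 , pos 1 , pos 0 ⟩
T (suc (suc (suc zero))) zero = ⟨ pos 0 , pos 0 , pos 0 , pos 1 ⟩
T (suc zero) (suc zero) = ⟨ neg 3 , pos 1 , pos 0 , pos 0 ⟩
T (suc zero) (suc (suc zero)) = ⟨ neg 6 , pos 12 , pos 6 , neg 33 ⟩
T (suc zero) (suc (suc (suc zero))) = ⟨ neg 2 , pos 2 , pos 1 , neg 5 ⟩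
T (suc (suc zero)) (suc zero) = ⟨ pos 6 , neg 12 , neg 5 , pos 33 ⟩
T (suc (suc zero)) (suc (suc zero)) = ⟨ neg 21 , pos 0 , pos 0 , pos 0 ⟩
T (suc (suc zero)) (suc (suc (suc zero))) = ⟨ neg 1 , neg 5 , neg 2 , pos 12 ⟩
T (suc (suc (suc zero))) (suc zero) = ⟨ pos 0 , neg 2 , neg 1 , pos 6 ⟩
T (suc (suc (suc zero))) (suc (suc zero)) = ⟨ neg 6 , pos 5 , pos 2 , neg 12 ⟩
T (suc (suc (suc zero))) (suc (suc (suc zero))) = ⟨ neg 1 , pos 0 , pos 0 , pos 0 ⟩

module OrderOver (R : CoeffRing) where
  open CoeffRing R

  Elt : Set
  Elt = V4 A

  one : Elt
  one = ⟨ 1A , 0A , 0A , 0A ⟩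

  private
    sum4 : (Fin 4 → A) → A
    sum4 f = f zero +A (f (suc zero) +A (f (suc (suc zero)) +A f (suc (suc (suc zero)))))

  mulCoord : Elt → Elt → Fin 4 → A
  mulCoord x y k =
    sum4 (λ p → sum4 (λ q → (coord x p *A coord y q) *A fromℤ (coord (T p q) k)))

  _·_ : Elt → Elt → Elt
  x · y = ⟨ mulCoord x y zero , mulCoord x y (suc zero)
          , mulCoord x y (suc (suc zero)) , mulCoord x y (suc (suc (suc zero))) ⟩

  scale : A → Elt → Elt
  scale a ⟨ x₀ , x₁ , x₂ , x₃ ⟩ = ⟨ a *A x₀ , a *A x₁ , a *A x₂ , a *A x₃ ⟩

  IsUnitA : A → Set
  IsUnitA a = Σ A λ b → a *A b ≡ 1A

  IsUnit : Elt → Set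
  IsUnit x = Σ Elt λ y → (x · y ≡ one) × (y · x ≡ one)

  -- equality in G(A) = (O ⊗ A)^× / A^× : same class modulo scalar units
  _∼_ : Elt → Elt → Set
  x ∼ y = Σ A λ a → IsUnitA a × (x ≡ scale a y)

  -- H is a subgroup of G(A), given as a predicate on representatives
  -- (units of O ⊗ A) which is invariant under the quotient relation ∼
  record IsSubgroupG (H : Elt → Set) : Set where
    field
      ⊆units   : ∀ x → H x → IsUnit x
      resp-∼   : ∀ x y → H x → y ∼ x → H y
      has-one  : H one
      ·-closed : ∀ x y → H x → H y → H (x · y)
      inv-closed : ∀ x → H x → Σ Elt λ y → H y × ((x · y) ∼ one)

ℤRing : CoeffRing
ℤRing = record
  { A = ℤ ; _+A_ = ℤ._+_ ; _*A_ = ℤ._*_ ; 0A = + 0 ; 1A = + 1 ; fromℤ = λ z → z }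

oddℕ : ℕ → Bool
oddℕ zero = false
oddℕ (suc n) = not (oddℕ n)

red2 : ℤ → Bool
red2 z = oddℕ ∣ z ∣

ℤ/2Ring : CoeffRing
ℤ/2Ring = record
  { A = Bool ; _+A_ = _xor_ ; _*A_ = _∧_ ; 0A = false ; 1A = true ; fromℤ = red2 }

module Oℤ = OrderOver ℤRing
module O₂ = OrderOver ℤ/2Ring

φ₂ : Oℤ.Elt → O₂.Elt
φ₂ ⟨ a , b , c , d ⟩ = ⟨ red2 a , red2 b , red2 c , red2 d ⟩

_+₃_ : Fin 3 → Fin 3 → Fin 3
zero +₃ l = l
suc zero +₃ zero = suc zero
suc zero +₃ suc zero = suc (suc zero)
suc zero +₃ suc (suc zero) = zero
suc (suc zero) +₃ zero = suc (suc zero)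
suc (suc zero) +₃ suc zero = zero
suc (suc zero) +₃ suc (suc zero) = suc zero

IsoC₃ : (O₂.Elt → Set) → Set
IsoC₃ H = Σ (Fin 3 → O₂.Elt) λ f →
    (∀ k → H (f k))
  × (∀ k l → f k O₂.∼ f l → k ≡ l)
  × (∀ x → H x → Σ (Fin 3) λ k → x O₂.∼ f k)
  × (∀ k l → f (k +₃ l) O₂.∼ (f k O₂.· f l))

record CongruencePair2 (H : O₂.Elt → Set) : Set where
  field
    subgroup : O₂.IsSubgroupG H
    φ-injective : ∀ u v → Oℤ.IsUnit u → Oℤ.IsUnit v →
                  φ₂ u O₂.∼ φ₂ v → u Oℤ.∼ v
    trivial-∩ : ∀ x u → H x → Oℤ.IsUnit u → x O₂.∼ φ₂ u → x O₂.∼ O₂.one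
    product-all : ∀ x → O₂.IsUnit x →
                  Σ Oℤ.Elt λ u → Oℤ.IsUnit u × Σ O₂.Elt λ h → H h × (x O₂.∼ (φ₂ u O₂.· h))

-- The reduced norm nrd is multiplicative and positive definite:
-- 4·nrd(a + bω₁ + cω₂ + dω₃) = (2d + 2b + 7c)² + (2a + b)² + 7((b − 2c)² + c²).
-- Hence a unit has b = c = 0 and a² + d² = 1, so G(ℤ) = {1, ω₃}, and these
-- two classes stay distinct mod 2.  Modulo 2 the norm of a unit is still 1,
-- which leaves six elements of O/2O; they are H ∪ ω̄₃H, where H is generated
-- by ω̄₁, of order 3 since ω₁² = ω₁ − 3.

module Submission where

open import Defs
open import Data.Product using (Σ; Σ-syntax; _×_; _,_; proj₁; proj₂)
open import Data.Sum using (_⊎_; inj₁; inj₂)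
open import Data.Bool using (true; false; _∧_)
import Data.Bool.Properties as Boolₚ
open import Data.Fin using (Fin)
open import Data.Fin.Patterns using (0F; 1F; 2F)
open import Data.Empty using (⊥-elim)
open import Data.Nat as ℕ using (ℕ; zero; suc)
import Data.Nat.Properties as ℕₚ
open import Data.Integer as ℤ using (ℤ; +_; -[1+_]; ∣_∣)
import Data.Integer.Properties as ℤₚ
import Data.Integer.Solver as ℤSolver
open import Data.Integer.Tactic.RingSolver using (solve-∀)
import Algebra.Solver.Ring.Simple as Solver
import Algebra.Solver.Ring.AlmostCommutativeRing as ACR
open import Relation.Binary.PropositionalEquality

module ReducedNorm (R : CoeffRing) where
  open CoeffRing R renaming (_+A_ to infixl 6 _⊕_; _*A_ to infixl 7 _⊗_)

  nrd : V4 A → A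
  nrd ⟨ a , b , c , d ⟩ =
    a ⊗ a ⊕ a ⊗ b ⊕ fromℤ (+ 3) ⊗ b ⊗ b ⊕ fromℤ (+ 21) ⊗ c ⊗ c
      ⊕ fromℤ (+ 2) ⊗ b ⊗ d ⊕ fromℤ (+ 7) ⊗ c ⊗ d ⊕ d ⊗ d

open ReducedNorm ℤRing using (nrd)
open ReducedNorm ℤ/2Ring using () renaming (nrd to nrd₂)

module 𝔽₂Solver = Solver (ACR.fromCommutativeRing Boolₚ.xor-∧-commutativeRing) Boolₚ._≟_

-- Solver syntax as coefficients: the semantics of the generic product and
-- norm over these rings are definitionally those over ℤ resp. ℤ/2ℤ, so the
-- identities below are instances of the ring solver.
ℤ[X] : ℕ → CoeffRing
ℤ[X] n = record
  { A = Polynomial n ; _+A_ = _:+_ ; _*A_ = _:*_ ; 0A = con (+ 0) ; 1A = con (+ 1) ; fromℤ = con }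
  where open ℤSolver.+-*-Solver

𝔽₂[X] : ℕ → CoeffRing
𝔽₂[X] n = record
  { A = Polynomial n ; _+A_ = _:+_ ; _*A_ = _:*_ ; 0A = con false ; 1A = con true
  ; fromℤ = λ z → con (red2 z) }
  where open 𝔽₂Solver

nrd-· : ∀ x y → nrd (x Oℤ.· y) ≡ nrd x ℤ.* nrd y
nrd-· ⟨ a , b , c , d ⟩ ⟨ e , f , g , h ⟩ =
  solve 8 (λ a b c d e f g h →
    nrdᴾ (⟨ a , b , c , d ⟩ P.· ⟨ e , f , g , h ⟩) := nrdᴾ ⟨ a , b , c , d ⟩ :* nrdᴾ ⟨ e , f , g , h ⟩)
    refl a b c d e f g h
  where
  open ℤSolver.+-*-Solver
  module P = OrderOver (ℤ[X] 8)
  open ReducedNorm (ℤ[X] 8) renaming (nrd to nrdᴾ)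

nrd₂-· : ∀ x y → nrd₂ (x O₂.· y) ≡ nrd₂ x ∧ nrd₂ y
nrd₂-· ⟨ a , b , c , d ⟩ ⟨ e , f , g , h ⟩ =
  solve 8 (λ a b c d e f g h →
    nrdᴾ (⟨ a , b , c , d ⟩ P.· ⟨ e , f , g , h ⟩) := nrdᴾ ⟨ a , b , c , d ⟩ :* nrdᴾ ⟨ e , f , g , h ⟩)
    refl a b c d e f g h
  where
  open 𝔽₂Solver
  module P = OrderOver (𝔽₂[X] 8)
  open ReducedNorm (𝔽₂[X] 8) renaming (nrd to nrdᴾ)

nrd-a00d : ∀ a d → nrd ⟨ a , + 0 , + 0 , d ⟩ ≡ a ℤ.* a ℤ.+ d ℤ.* d
nrd-a00d = solve 2 (λ a d → nrdᴾ ⟨ a , con (+ 0) , con (+ 0) , d ⟩ := a :* a :+ d :* d) refl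
  where
  open ℤSolver.+-*-Solver
  open ReducedNorm (ℤ[X] 2) renaming (nrd to nrdᴾ)

∣_∣² : ℤ → ℕ
∣ i ∣² = ∣ i ∣ ℕ.* ∣ i ∣

square≡∣∣² : ∀ i → i ℤ.* i ≡ + ∣ i ∣²
square≡∣∣² (+ n) = sym (ℤₚ.pos-* n n)
square≡∣∣² -[1+ n ] = refl

m*m≡0⇒m≡0 : ∀ m → m ℕ.* m ≡ 0 → m ≡ 0
m*m≡0⇒m≡0 zero _ = refl
m*m≡0⇒m≡0 (suc _) ()

m+n*o<n⇒o≡0 : ∀ m n o → m ℕ.+ n ℕ.* o ℕ.< n → o ≡ 0
m+n*o<n⇒o≡0 m n zero _ = refl
m+n*o<n⇒o≡0 m n o@(suc _) lt =
  ⊥-elim (ℕₚ.<-irrefl refl (ℕₚ.<-≤-trans lt (ℕₚ.≤-trans (ℕₚ.m≤m*n n o) (ℕₚ.m≤n+m (n ℕ.* o) m))))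

m*m+n*n≡1 : ∀ m n → m ℕ.* m ℕ.+ n ℕ.* n ≡ 1 → (m ≡ 1 × n ≡ 0) ⊎ (m ≡ 0 × n ≡ 1)
m*m+n*n≡1 0 1 _ = inj₂ (refl , refl)
m*m+n*n≡1 1 0 _ = inj₁ (refl , refl)
m*m+n*n≡1 0 0 ()
m*m+n*n≡1 0 (suc (suc n)) ()
m*m+n*n≡1 1 (suc n) ()
m*m+n*n≡1 (suc (suc m)) n ()

∣i∣²≡0⇒i≡0 : ∀ i → ∣ i ∣² ≡ 0 → i ≡ + 0
∣i∣²≡0⇒i≡0 i eq = ℤₚ.∣i∣≡0⇒i≡0 (m*m≡0⇒m≡0 ∣ i ∣ eq)

isUnitℤ⇒∣∣≡1 : ∀ i j → i ℤ.* j ≡ + 1 → ∣ i ∣ ≡ 1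
isUnitℤ⇒∣∣≡1 i j ij≡1 = ℕₚ.m*n≡1⇒m≡1 ∣ i ∣ ∣ j ∣ (trans (sym (ℤₚ.abs-* i j)) (cong ∣_∣ ij≡1))

∣i∣≡1⇒i*i≡1 : ∀ i → ∣ i ∣ ≡ 1 → i ℤ.* i ≡ + 1
∣i∣≡1⇒i*i≡1 i ∣i∣≡1 = trans (square≡∣∣² i) (cong (λ n → + (n ℕ.* n)) ∣i∣≡1)

V4-cong : ∀ {X : Set} {x₀ y₀ x₁ y₁ x₂ y₂ x₃ y₃ : X} →
  x₀ ≡ y₀ → x₁ ≡ y₁ → x₂ ≡ y₂ → x₃ ≡ y₃ → ⟨ x₀ , x₁ , x₂ , x₃ ⟩ ≡ ⟨ y₀ , y₁ , y₂ , y₃ ⟩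
V4-cong refl refl refl refl = refl

scale-assoc : ∀ a b x → Oℤ.scale a (Oℤ.scale b x) ≡ Oℤ.scale (a ℤ.* b) x
scale-assoc a b ⟨ x₀ , x₁ , x₂ , x₃ ⟩ =
  sym (V4-cong (ℤₚ.*-assoc a b x₀) (ℤₚ.*-assoc a b x₁) (ℤₚ.*-assoc a b x₂) (ℤₚ.*-assoc a b x₃))

scale-identity : ∀ x → Oℤ.scale (+ 1) x ≡ x
scale-identity ⟨ x₀ , x₁ , x₂ , x₃ ⟩ =
  V4-cong (ℤₚ.*-identityˡ x₀) (ℤₚ.*-identityˡ x₁) (ℤₚ.*-identityˡ x₂) (ℤₚ.*-identityˡ x₃)

scale-∼ : ∀ a x → ∣ a ∣ ≡ 1 → Oℤ.scale a x Oℤ.∼ x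
scale-∼ a x ∣a∣≡1 = a , (a , ∣i∣≡1⇒i*i≡1 a ∣a∣≡1) , refl

∼-sym : ∀ {x y} → x Oℤ.∼ y → y Oℤ.∼ x
∼-sym {y = y} (a , (b , ab≡1) , refl) = b , (a , ba≡1) , (begin
  y                             ≡⟨ scale-identity y ⟨
  Oℤ.scale (+ 1) y              ≡⟨ cong (λ s → Oℤ.scale s y) ba≡1 ⟨
  Oℤ.scale (b ℤ.* a) y          ≡⟨ scale-assoc b a y ⟨
  Oℤ.scale b (Oℤ.scale a y)     ∎)
  where
  open ≡-Reasoning
  ba≡1 = trans (ℤₚ.*-comm b a) ab≡1

∼-trans : ∀ {x y z} → x Oℤ.∼ y → y Oℤ.∼ z → x Oℤ.∼ z
∼-trans {z = z} (a , (a′ , aa′≡1) , refl) (b , (b′ , bb′≡1) , refl) =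
  a ℤ.* b , (a′ ℤ.* b′ , ab-inverse) , scale-assoc a b z
  where
  interchange : ∀ a b a′ b′ → (a ℤ.* b) ℤ.* (a′ ℤ.* b′) ≡ (a ℤ.* a′) ℤ.* (b ℤ.* b′)
  interchange = solve-∀
  ab-inverse = trans (interchange a b a′ b′) (cong₂ ℤ._*_ aa′≡1 bb′≡1)

module _ (a b c d : ℤ) where
  private
    X Y Z : ℤ
    X = + 2 ℤ.* d ℤ.+ + 2 ℤ.* b ℤ.+ + 7 ℤ.* c
    Y = + 2 ℤ.* a ℤ.+ b
    Z = b ℤ.- + 2 ℤ.* c

  nrd-sumOfSquares : + 4 ℤ.* nrd ⟨ a , b , c , d ⟩ ≡ X ℤ.* X ℤ.+ Y ℤ.* Y ℤ.+ + 7 ℤ.* (Z ℤ.* Z ℤ.+ c ℤ.* c)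
  nrd-sumOfSquares =
    solve 4 (λ a b c d →
      let X = two :* d :+ two :* b :+ con (+ 7) :* c
          Y = two :* a :+ b
          Z = b :- two :* c
      in con (+ 4) :* nrdᴾ ⟨ a , b , c , d ⟩ := X :* X :+ Y :* Y :+ con (+ 7) :* (Z :* Z :+ c :* c))
      refl a b c d
    where
    open ℤSolver.+-*-Solver
    open ReducedNorm (ℤ[X] 4) renaming (nrd to nrdᴾ)
    two = con (+ 2)

  nrd-sumOfSquaresℕ : + 4 ℤ.* nrd ⟨ a , b , c , d ⟩ ≡ + (∣ X ∣² ℕ.+ ∣ Y ∣² ℕ.+ 7 ℕ.* (∣ Z ∣² ℕ.+ ∣ c ∣²))
  nrd-sumOfSquaresℕ = begin
    + 4 ℤ.* nrd ⟨ a , b , c , d ⟩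
      ≡⟨ nrd-sumOfSquares ⟩
    X ℤ.* X ℤ.+ Y ℤ.* Y ℤ.+ + 7 ℤ.* (Z ℤ.* Z ℤ.+ c ℤ.* c)
      ≡⟨ cong₂ ℤ._+_ (cong₂ ℤ._+_ (square≡∣∣² X) (square≡∣∣² Y))
                     (cong (+ 7 ℤ.*_) (cong₂ ℤ._+_ (square≡∣∣² Z) (square≡∣∣² c))) ⟩
    + (∣ X ∣² ℕ.+ ∣ Y ∣²) ℤ.+ + 7 ℤ.* + (∣ Z ∣² ℕ.+ ∣ c ∣²)
      ≡⟨ cong (ℤ._+_ (+ (∣ X ∣² ℕ.+ ∣ Y ∣²))) (ℤₚ.pos-* 7 (∣ Z ∣² ℕ.+ ∣ c ∣²)) ⟨
    + (∣ X ∣² ℕ.+ ∣ Y ∣² ℕ.+ 7 ℕ.* (∣ Z ∣² ℕ.+ ∣ c ∣²)) ∎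
    where open ≡-Reasoning

  nrd≡1⇒b≡0×c≡0 : nrd ⟨ a , b , c , d ⟩ ≡ + 1 → b ≡ + 0 × c ≡ + 0
  nrd≡1⇒b≡0×c≡0 nrd≡1 = b≡0 , c≡0
    where
    open ≡-Reasoning
    sum≡4 : ∣ X ∣² ℕ.+ ∣ Y ∣² ℕ.+ 7 ℕ.* (∣ Z ∣² ℕ.+ ∣ c ∣²) ≡ 4
    sum≡4 = ℤₚ.+-injective (trans (sym nrd-sumOfSquaresℕ) (cong (+ 4 ℤ.*_) nrd≡1))
    Z²+c²≡0 : ∣ Z ∣² ℕ.+ ∣ c ∣² ≡ 0
    Z²+c²≡0 = m+n*o<n⇒o≡0 (∣ X ∣² ℕ.+ ∣ Y ∣²) 7 (∣ Z ∣² ℕ.+ ∣ c ∣²)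
                (subst (ℕ._< 7) (sym sum≡4) (ℕₚ.m<m+n 4 ℕₚ.0<1+n))
    c≡0 : c ≡ + 0
    c≡0 = ∣i∣²≡0⇒i≡0 c (ℕₚ.m+n≡0⇒n≡0 ∣ Z ∣² Z²+c²≡0)
    b≡0 : b ≡ + 0
    b≡0 = begin
      b                  ≡⟨ ℤₚ.+-identityʳ b ⟨
      b ℤ.- + 2 ℤ.* + 0  ≡⟨ cong (λ c → b ℤ.- + 2 ℤ.* c) c≡0 ⟨
      Z                  ≡⟨ ∣i∣²≡0⇒i≡0 Z (ℕₚ.m+n≡0⇒m≡0 ∣ Z ∣² Z²+c²≡0) ⟩
      + 0                ∎

nrd-nonneg : ∀ x → + ∣ nrd x ∣ ≡ nrd x
nrd-nonneg ⟨ a , b , c , d ⟩ = nonneg (nrd ⟨ a , b , c , d ⟩) (nrd-sumOfSquaresℕ a b c d)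
  where
  nonneg : ∀ i {n} → + 4 ℤ.* i ≡ + n → + ∣ i ∣ ≡ i
  nonneg (+ _) _ = refl
  nonneg -[1+ _ ] ()

isUnit⇒nrd≡1 : ∀ u → Oℤ.IsUnit u → nrd u ≡ + 1
isUnit⇒nrd≡1 u (v , uv≡1 , _) = begin
  nrd u        ≡⟨ nrd-nonneg u ⟨
  + ∣ nrd u ∣  ≡⟨ cong +_ (isUnitℤ⇒∣∣≡1 (nrd u) (nrd v) nrd-u*nrd-v≡1) ⟩
  + 1          ∎
  where
  open ≡-Reasoning
  nrd-u*nrd-v≡1 : nrd u ℤ.* nrd v ≡ + 1
  nrd-u*nrd-v≡1 = trans (sym (nrd-· u v)) (cong nrd uv≡1)

ω₃ : Oℤ.Elt
ω₃ = ⟨ + 0 , + 0 , + 0 , + 1 ⟩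

scale-one : ∀ a → Oℤ.scale a Oℤ.one ≡ ⟨ a , + 0 , + 0 , + 0 ⟩
scale-one a = V4-cong (ℤₚ.*-identityʳ a) (ℤₚ.*-zeroʳ a) (ℤₚ.*-zeroʳ a) (ℤₚ.*-zeroʳ a)

scale-ω₃ : ∀ d → Oℤ.scale d ω₃ ≡ ⟨ + 0 , + 0 , + 0 , d ⟩
scale-ω₃ d = V4-cong (ℤₚ.*-zeroʳ d) (ℤₚ.*-zeroʳ d) (ℤₚ.*-zeroʳ d) (ℤₚ.*-identityʳ d)

nrd≡1⇒a²+d²≡1 : ∀ a d → nrd ⟨ a , + 0 , + 0 , d ⟩ ≡ + 1 → ∣ a ∣² ℕ.+ ∣ d ∣² ≡ 1
nrd≡1⇒a²+d²≡1 a d nrd≡1 = ℤₚ.+-injective (begin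
  + (∣ a ∣² ℕ.+ ∣ d ∣²)      ≡⟨ cong₂ ℤ._+_ (square≡∣∣² a) (square≡∣∣² d) ⟨
  a ℤ.* a ℤ.+ d ℤ.* d        ≡⟨ nrd-a00d a d ⟨
  nrd ⟨ a , + 0 , + 0 , d ⟩  ≡⟨ nrd≡1 ⟩
  + 1                        ∎)
  where open ≡-Reasoning

a²+d²≡1⇒∼ : ∀ a d → ∣ a ∣² ℕ.+ ∣ d ∣² ≡ 1 →
  ⟨ a , + 0 , + 0 , d ⟩ Oℤ.∼ Oℤ.one ⊎ ⟨ a , + 0 , + 0 , d ⟩ Oℤ.∼ ω₃
a²+d²≡1⇒∼ a d a²+d²≡1 with m*m+n*n≡1 ∣ a ∣ ∣ d ∣ a²+d²≡1
... | inj₁ (∣a∣≡1 , ∣d∣≡0) with refl ← ℤₚ.∣i∣≡0⇒i≡0 {d} ∣d∣≡0 =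
  inj₁ (subst (Oℤ._∼ Oℤ.one) (scale-one a) (scale-∼ a Oℤ.one ∣a∣≡1))
... | inj₂ (∣a∣≡0 , ∣d∣≡1) with refl ← ℤₚ.∣i∣≡0⇒i≡0 {a} ∣a∣≡0 =
  inj₂ (subst (Oℤ._∼ ω₃) (scale-ω₃ d) (scale-∼ d ω₃ ∣d∣≡1))

nrd≡1⇒∼ : ∀ a b c d → nrd ⟨ a , b , c , d ⟩ ≡ + 1 →
  ⟨ a , b , c , d ⟩ Oℤ.∼ Oℤ.one ⊎ ⟨ a , b , c , d ⟩ Oℤ.∼ ω₃
nrd≡1⇒∼ a b c d nrd≡1 =
  subst₂ (λ b c → ⟨ a , b , c , d ⟩ Oℤ.∼ Oℤ.one ⊎ ⟨ a , b , c , d ⟩ Oℤ.∼ ω₃) (sym b≡0) (sym c≡0)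
    (a²+d²≡1⇒∼ a d (nrd≡1⇒a²+d²≡1 a d (subst₂ (λ b c → nrd ⟨ a , b , c , d ⟩ ≡ + 1) b≡0 c≡0 nrd≡1)))
  where
  b≡0 = proj₁ (nrd≡1⇒b≡0×c≡0 a b c d nrd≡1)
  c≡0 = proj₂ (nrd≡1⇒b≡0×c≡0 a b c d nrd≡1)

unit-classes : ∀ u → Oℤ.IsUnit u → u Oℤ.∼ Oℤ.one ⊎ u Oℤ.∼ ω₃
unit-classes u@(⟨ a , b , c , d ⟩) isUnit = nrd≡1⇒∼ a b c d (isUnit⇒nrd≡1 u isUnit)

red2-* : ∀ a → ∣ a ∣ ≡ 1 → ∀ z → red2 (a ℤ.* z) ≡ red2 z
red2-* a ∣a∣≡1 z = cong oddℕ (begin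
  ∣ a ℤ.* z ∣           ≡⟨ ℤₚ.abs-* a z ⟩
  ∣ a ∣ ℕ.* ∣ z ∣       ≡⟨ cong (ℕ._* ∣ z ∣) ∣a∣≡1 ⟩
  1 ℕ.* ∣ z ∣           ≡⟨ ℕₚ.*-identityˡ ∣ z ∣ ⟩
  ∣ z ∣                 ∎)
  where open ≡-Reasoning

φ₂-scale : ∀ a → ∣ a ∣ ≡ 1 → ∀ x → φ₂ (Oℤ.scale a x) ≡ φ₂ x
φ₂-scale a ∣a∣≡1 ⟨ x₀ , x₁ , x₂ , x₃ ⟩ =
  V4-cong (red2-* a ∣a∣≡1 x₀) (red2-* a ∣a∣≡1 x₁) (red2-* a ∣a∣≡1 x₂) (red2-* a ∣a∣≡1 x₃)

φ₂-resp-∼ : ∀ {u v} → u Oℤ.∼ v → φ₂ u ≡ φ₂ v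
φ₂-resp-∼ {v = v} (a , (b , ab≡1) , refl) = φ₂-scale a (isUnitℤ⇒∣∣≡1 a b ab≡1) v

∼₂⇒≡ : ∀ {x y} → x O₂.∼ y → x ≡ y
∼₂⇒≡ (true , _ , x≡y) = x≡y
∼₂⇒≡ (false , (_ , ()) , _)

≡⇒∼₂ : ∀ {x y} → x ≡ y → x O₂.∼ y
≡⇒∼₂ refl = true , (true , refl) , refl

φ₂1≢φ₂ω₃ : φ₂ Oℤ.one ≢ φ₂ ω₃
φ₂1≢φ₂ω₃ ()

φ₂-reflects-∼ : ∀ u v → Oℤ.IsUnit u → Oℤ.IsUnit v → φ₂ u O₂.∼ φ₂ v → u Oℤ.∼ v
φ₂-reflects-∼ u v isUnit-u isUnit-v φu∼φv = reflect (unit-classes u isUnit-u) (unit-classes v isUnit-v)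
  where
  φu≡φv = ∼₂⇒≡ φu∼φv
  reflect : u Oℤ.∼ Oℤ.one ⊎ u Oℤ.∼ ω₃ → v Oℤ.∼ Oℤ.one ⊎ v Oℤ.∼ ω₃ → u Oℤ.∼ v
  reflect (inj₁ u∼1) (inj₁ v∼1) = ∼-trans u∼1 (∼-sym v∼1)
  reflect (inj₂ u∼ω) (inj₂ v∼ω) = ∼-trans u∼ω (∼-sym v∼ω)
  reflect (inj₁ u∼1) (inj₂ v∼ω) =
    ⊥-elim (φ₂1≢φ₂ω₃ (trans (sym (φ₂-resp-∼ u∼1)) (trans φu≡φv (φ₂-resp-∼ v∼ω))))
  reflect (inj₂ u∼ω) (inj₁ v∼1) =
    ⊥-elim (φ₂1≢φ₂ω₃ (trans (sym (φ₂-resp-∼ v∼1)) (trans (sym φu≡φv) (φ₂-resp-∼ u∼ω))))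

ω̄₁^_ : Fin 3 → O₂.Elt
ω̄₁^ 0F = O₂.one
ω̄₁^ 1F = ⟨ false , true , false , false ⟩
ω̄₁^ 2F = ⟨ true , true , false , false ⟩

ω̄₁^-+ : ∀ k l → ω̄₁^ (k +₃ l) ≡ (ω̄₁^ k) O₂.· (ω̄₁^ l)
ω̄₁^-+ 0F 0F = refl
ω̄₁^-+ 0F 1F = refl
ω̄₁^-+ 0F 2F = refl
ω̄₁^-+ 1F 0F = refl
ω̄₁^-+ 1F 1F = refl
ω̄₁^-+ 1F 2F = refl
ω̄₁^-+ 2F 0F = refl
ω̄₁^-+ 2F 1F = refl
ω̄₁^-+ 2F 2F = refl

ω̄₁^-inverse : ∀ k → Σ[ l ∈ Fin 3 ] ((ω̄₁^ k) O₂.· (ω̄₁^ l) ≡ O₂.one) × ((ω̄₁^ l) O₂.· (ω̄₁^ k) ≡ O₂.one)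
ω̄₁^-inverse 0F = 0F , refl , refl
ω̄₁^-inverse 1F = 2F , refl , refl
ω̄₁^-inverse 2F = 1F , refl , refl

ω̄₁^-injective : ∀ k l → ω̄₁^ k ≡ ω̄₁^ l → k ≡ l
ω̄₁^-injective 0F 0F _ = refl
ω̄₁^-injective 1F 1F _ = refl
ω̄₁^-injective 2F 2F _ = refl
ω̄₁^-injective 0F 1F ()
ω̄₁^-injective 0F 2F ()
ω̄₁^-injective 1F 0F ()
ω̄₁^-injective 1F 2F ()
ω̄₁^-injective 2F 0F ()
ω̄₁^-injective 2F 1F ()

ω̄₁^≢ω̄₃ : ∀ k → ω̄₁^ k ≢ φ₂ ω₃
ω̄₁^≢ω̄₃ 0F ()
ω̄₁^≢ω̄₃ 1F ()
ω̄₁^≢ω̄₃ 2F ()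

H : O₂.Elt → Set
H x = Σ[ k ∈ Fin 3 ] x ≡ ω̄₁^ k

H-subgroup : O₂.IsSubgroupG H
H-subgroup = record
  { ⊆units     = λ { _ (k , refl) → let l , kl≡1 , lk≡1 = ω̄₁^-inverse k in ω̄₁^ l , kl≡1 , lk≡1 }
  ; resp-∼     = λ { _ _ Hx y∼x → subst H (sym (∼₂⇒≡ y∼x)) Hx }
  ; has-one    = 0F , refl
  ; ·-closed   = λ { _ _ (k , refl) (l , refl) → k +₃ l , sym (ω̄₁^-+ k l) }
  ; inv-closed = λ { _ (k , refl) → let l , kl≡1 , _ = ω̄₁^-inverse k in ω̄₁^ l , (l , refl) , ≡⇒∼₂ kl≡1 }
  }

H≅C₃ : IsoC₃ H
H≅C₃ =
    ω̄₁^_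
  , (λ k → k , refl)
  , (λ k l ω̄₁^k∼ω̄₁^l → ω̄₁^-injective k l (∼₂⇒≡ ω̄₁^k∼ω̄₁^l))
  , (λ { _ (k , refl) → k , ≡⇒∼₂ refl })
  , (λ k l → ≡⇒∼₂ (ω̄₁^-+ k l))

H∩φ₂G≡1 : ∀ x u → H x → Oℤ.IsUnit u → x O₂.∼ φ₂ u → x O₂.∼ O₂.one
H∩φ₂G≡1 x u (k , refl) isUnit x∼φu = meet (unit-classes u isUnit)
  where
  x≡φu = ∼₂⇒≡ x∼φu
  meet : u Oℤ.∼ Oℤ.one ⊎ u Oℤ.∼ ω₃ → x O₂.∼ O₂.one
  meet (inj₁ u∼1) = ≡⇒∼₂ (trans x≡φu (φ₂-resp-∼ u∼1))
  meet (inj₂ u∼ω) = ⊥-elim (ω̄₁^≢ω̄₃ k (trans x≡φu (φ₂-resp-∼ u∼ω)))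

-- nrd₂ ⟨ a , b , c , d ⟩ = (a ∨ b) xor (c ∨ d), so exactly six elements have norm 1.
nrd₂≡1⇒∈φ₂G·H : ∀ x → nrd₂ x ≡ true →
  Σ[ u ∈ Oℤ.Elt ] (u ≡ Oℤ.one ⊎ u ≡ ω₃) × Σ[ k ∈ Fin 3 ] x ≡ φ₂ u O₂.· (ω̄₁^ k)
nrd₂≡1⇒∈φ₂G·H ⟨ true  , false , false , false ⟩ _ = Oℤ.one , inj₁ refl , 0F , refl
nrd₂≡1⇒∈φ₂G·H ⟨ false , true  , false , false ⟩ _ = Oℤ.one , inj₁ refl , 1F , refl
nrd₂≡1⇒∈φ₂G·H ⟨ true  , true  , false , false ⟩ _ = Oℤ.one , inj₁ refl , 2F , refl
nrd₂≡1⇒∈φ₂G·H ⟨ false , false , false , true  ⟩ _ = ω₃ , inj₂ refl , 0F , refl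
nrd₂≡1⇒∈φ₂G·H ⟨ false , false , true  , false ⟩ _ = ω₃ , inj₂ refl , 1F , refl
nrd₂≡1⇒∈φ₂G·H ⟨ false , false , true  , true  ⟩ _ = ω₃ , inj₂ refl , 2F , refl
nrd₂≡1⇒∈φ₂G·H ⟨ false , false , false , false ⟩ ()
nrd₂≡1⇒∈φ₂G·H ⟨ true  , false , false , true  ⟩ ()
nrd₂≡1⇒∈φ₂G·H ⟨ true  , false , true  , false ⟩ ()
nrd₂≡1⇒∈φ₂G·H ⟨ true  , false , true  , true  ⟩ ()
nrd₂≡1⇒∈φ₂G·H ⟨ false , true  , false , true  ⟩ ()
nrd₂≡1⇒∈φ₂G·H ⟨ false , true  , true  , false ⟩ ()
nrd₂≡1⇒∈φ₂G·H ⟨ false , true  , true  , true  ⟩ ()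
nrd₂≡1⇒∈φ₂G·H ⟨ true  , true  , false , true  ⟩ ()
nrd₂≡1⇒∈φ₂G·H ⟨ true  , true  , true  , false ⟩ ()
nrd₂≡1⇒∈φ₂G·H ⟨ true  , true  , true  , true  ⟩ ()

isUnit₂⇒nrd₂≡1 : ∀ x → O₂.IsUnit x → nrd₂ x ≡ true
isUnit₂⇒nrd₂≡1 x (y , xy≡1 , _) = x∧y≡true⇒x≡true (nrd₂ x) (trans (sym (nrd₂-· x y)) (cong nrd₂ xy≡1))
  where
  x∧y≡true⇒x≡true : ∀ x {y} → x ∧ y ≡ true → x ≡ true
  x∧y≡true⇒x≡true true _ = refl
  x∧y≡true⇒x≡true false ()

φ₂G·H≡G : ∀ x → O₂.IsUnit x →
  Σ Oℤ.Elt λ u → Oℤ.IsUnit u × Σ O₂.Elt λ h → H h × (x O₂.∼ (φ₂ u O₂.· h))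
φ₂G·H≡G x isUnit =
  let u , u∈1ω₃ , k , x≡φu·h = nrd₂≡1⇒∈φ₂G·H x (isUnit₂⇒nrd₂≡1 x isUnit)
  in u , isUnit-u u∈1ω₃ , ω̄₁^ k , (k , refl) , ≡⇒∼₂ x≡φu·h
  where
  isUnit-u : ∀ {u} → u ≡ Oℤ.one ⊎ u ≡ ω₃ → Oℤ.IsUnit u
  isUnit-u (inj₁ refl) = Oℤ.one , refl , refl
  isUnit-u (inj₂ refl) = ⟨ + 0 , + 0 , + 0 , -[1+ 0 ] ⟩ , refl , refl

proposition5p11 : Σ (O₂.Elt → Set) λ H → IsoC₃ H × CongruencePair2 H
proposition5p11 = H , H≅C₃ , record
  { subgroup    = H-subgroup
  ; φ-injective = φ₂-reflects-∼
  ; trivial-∩   = H∩φ₂G≡1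
  ; product-all = φ₂G·H≡G
  }
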